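{- Let $G$ be a minimal matching covered bipartite graph with a bipartite ear decomposition $C+P_{1}+P_{2}+\cdots+P_{k}$. Let $P_{k+1}$ be a nontrivial ear of $G$ whose two ends are two nonadjacent vertices of $P_k$ lying in different parts (color classes) of $G$, and let $G'=G+P_{k+1}$. Then $G'$ is a minimal matching covered bipartite graph.
   Context: All graphs are finite and simple. A connected nontrivial graph is matching covered if every edge lies in some perfect matching; a matching covered graph $G$ is minimal if $G-e$ is not matching covered for every edge $e$. An ear of a graph $H$ is a path of odd length whose two ends lie in $H$ but whose internal vertices (and edges) do not; it is trivial if it has exactly one edge and nontrivial otherwise. For a bipartite graph $G$, a bipartite ear decomposition is a sequence $G_0=K_2, G_1,\dots,G_k=G$ of subgraphs with $G_{i+1}=G_i+P_{i+1}$ where $P_{i+1}$ is an ear of $G_i$ joining vertices in different parts of $G_i$; then $G_1=G_0+P_1$ is an even cycle, and the decomposition is written $C+P_1+\cdots+P_k$ with $C=G_1$ and the later ears relabeled $P_1,\dots,P_k$. For a graph $H$ and an ear $P$ of $H$, $H+P$ denotes the union of $H$ and $P$. -}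

module Defs where

open import Data.Nat using (ℕ; _+_; _<_)
open import Data.Bool using (Bool)
open import Data.List using (List; []; _∷_; _++_; length)
open import Data.List.Membership.Propositional using (_∈_)
open import Data.List.Relation.Unary.All using (All)
open import Data.List.Relation.Unary.Unique.Propositional using (Unique)
open import Data.Product using (Σ; ∃; _×_; _,_; proj₁; proj₂)
open import Data.Sum using (_⊎_)
open import Relation.Nullary using (¬_)
open import Relation.Binary.PropositionalEquality using (_≡_; _≢_)
open import Level using (0ℓ)

record Graph : Set₁ where
  field
    V : ℕ → Set
    E : ℕ → ℕ → Set
open Graph public

record IsGraph (G : Graph) : Set where
  field
    E-sym  : ∀ {u v} → E G u v → E G v u
    E-irr  : ∀ {u} → ¬ E G u u
    E-V    : ∀ {u v} → E G u v → V G u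
    finite : ∃ λ N → ∀ {u} → V G u → u < N
open IsGraph public

record _≅_ (G H : Graph) : Set where
  field
    V-iff : ∀ v → (V G v → V H v) × (V H v → V G v)
    E-iff : ∀ u v → (E G u v → E H u v) × (E H u v → E G u v)

data Walk (G : Graph) : ℕ → ℕ → Set where
  here : ∀ {u} → Walk G u u
  step : ∀ {u w v} → E G u w → Walk G w v → Walk G u v

Connected : Graph → Set
Connected G = ∀ u v → V G u → V G v → Walk G u v

Nontrivial : Graph → Set
Nontrivial G = ∃ λ u → ∃ λ v → V G u × V G v × u ≢ v

record PerfectMatching (G : Graph) (M : ℕ → ℕ → Set) : Set where
  field
    M⊆E   : ∀ {u v} → M u v → E G u v
    M-sym : ∀ {u v} → M u v → M v u
    cover : ∀ v → V G v → ∃ λ u → M v u × (∀ w → M v w → w ≡ u)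

MatchingCovered : Graph → Set₁
MatchingCovered G =
  Connected G × Nontrivial G ×
  (∀ u v → E G u v → Σ (ℕ → ℕ → Set) λ M → PerfectMatching G M × M u v)

_-edge_ : Graph → ℕ × ℕ → Graph
V (G -edge (a , b)) x = V G x
E (G -edge (a , b)) u v =
  E G u v × ¬ ((u ≡ a × v ≡ b) ⊎ (u ≡ b × v ≡ a))

MinimalMatchingCovered : Graph → Set₁
MinimalMatchingCovered G =
  MatchingCovered G × (∀ u v → E G u v → ¬ MatchingCovered (G -edge (u , v)))

ProperColoring : Graph → (ℕ → Bool) → Set
ProperColoring G c = ∀ u v → E G u v → c u ≢ c v

Bipartite : Graph → Set
Bipartite G = ∃ λ c → ProperColoring G c

DiffParts : Graph → ℕ → ℕ → Set
DiffParts G u v = ∀ c → ProperColoring G c → c u ≢ c v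

pairs : List ℕ → List (ℕ × ℕ)
pairs (x ∷ y ∷ xs) = (x , y) ∷ pairs (y ∷ xs)
pairs _ = []

PathEdge : List ℕ → ℕ → ℕ → Set
PathEdge xs u v = ((u , v) ∈ pairs xs) ⊎ ((v , u) ∈ pairs xs)

-- An ear of H: a path start, inner..., end of odd length
-- (length inner even), with distinct vertices, ends in H, internal
-- vertices and all edges not in H.
record Ear (H : Graph) : Set where
  field
    start : ℕ
    inner : List ℕ
    end   : ℕ
  verts : List ℕ
  verts = start ∷ inner ++ end ∷ []
  field
    oddLength : ∃ λ k → length inner ≡ k + k
    distinct  : Unique verts
    startV    : V H start
    endV      : V H end
    innerOut  : All (λ x → ¬ V H x) inner
    edgesOut  : All (λ p → ¬ E H (proj₁ p) (proj₂ p)) (pairs verts)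
open Ear public

Nontrivial-Ear : ∀ {H} → Ear H → Set
Nontrivial-Ear P = inner P ≢ []

_⊕_ : (H : Graph) → Ear H → Graph
V (H ⊕ P) x = V H x ⊎ x ∈ verts P
E (H ⊕ P) u v = E H u v ⊎ PathEdge (verts P) u v

K2 : ℕ → ℕ → Graph
V (K2 a b) x = x ≡ a ⊎ x ≡ b
E (K2 a b) u v = (u ≡ a × v ≡ b) ⊎ (u ≡ b × v ≡ a)

data BipEarDecomp : ℕ → Graph → Set₁ where
  base : ∀ a b → a ≢ b → BipEarDecomp 0 (K2 a b)
  add  : ∀ {n H} → BipEarDecomp n H → (P : Ear H) →
         DiffParts H (start P) (end P) → BipEarDecomp (Data.Nat.suc n) (H ⊕ P)

{-# OPTIONS --safe #-}
-- The ends s, t of P cut out of Pₖ a segment S whose interior Y has degree two in G; as s and t lie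
-- in different parts, Y and the interior X of P have even length. Along such a bare path a perfect
-- matching is forced: it pairs up either the whole path or just its interior. So every perfect
-- matching of G extends to G + P, by pairing up X or, if it pairs up S, by rerouting it through P;
-- hence G + P is matching covered. An edge of S or P is essential: deleting it leaves a vertex of
-- degree one, which a matching covered graph on three or more vertices cannot have. For any other
-- edge ab of G, if G + P − ab were matching covered then so would be G − ab, contradicting
-- minimality: contracting P onto S preserves connectivity, and a perfect matching of G + P − ab
-- pairs up X or all of P, so it restricts to G − ab, after rerouting from P back through S in the
-- second case. The edges y₁y₂, y₃y₄, … of Y are covered using an edge that leaves the cycle
-- S ∪ P at s or t: a perfect matching through it pairs up both X and Y.
module Submission where

open import Defs
open import Data.Bool using (Bool; not)
open import Data.Bool.Properties using (not-involutive; not-¬; ¬-not)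
open import Data.Empty using (⊥; ⊥-elim)
open import Data.List using (List; []; _∷_; _++_; length; reverse)
open import Data.List.Membership.Propositional using (_∈_; _∉_)
open import Data.List.Membership.Propositional.Properties using (∈-++⁺ˡ; ∈-++⁺ʳ; ∈-++⁻; ∈-∃++)
open import Data.List.Properties
  using (++-assoc; ∷-injective; ++-conicalʳ; unfold-reverse; reverse-++; reverse-involutive)
open import Data.List.Relation.Binary.Permutation.Propositional using (↭-sym; ↭⇒↭ₛ)
open import Data.List.Relation.Binary.Permutation.Propositional.Properties using (↭-reverse)
open import Data.List.Relation.Binary.Subset.Propositional using (_⊆_)
open import Data.List.Relation.Unary.All as All using (All; []; _∷_)
import Data.List.Relation.Unary.All.Properties as All
import Data.List.Relation.Unary.AllPairs as AllPairs
open import Data.List.Relation.Unary.Any using (here; there)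
import Data.List.Relation.Unary.Any.Properties as Any
open import Data.List.Relation.Unary.Unique.Propositional using (Unique; []; _∷_)
import Data.List.Relation.Unary.Unique.Propositional.Properties as Unique
open import Data.Nat using (ℕ; zero; suc; _+_; _≤_; _≟_)
open import Data.Nat.ListAction using (sum)
open import Data.Nat.Properties
  using (+-suc; suc-injective; m≤m+n; m≤n+m; ≤-trans; <-≤-trans; ≤-<-trans; n<1+n)
open import Data.List.Membership.DecPropositional _≟_ using (_∈?_)
open import Data.Product using (Σ; ∃; ∃₂; _×_; _,_; proj₁; proj₂)
import Data.Product as Product
open import Data.Product.Properties using (≡-dec)
open import Data.List.Membership.DecPropositional (≡-dec _≟_ _≟_) using () renaming (_∈?_ to _∈²?_)
open import Data.Sum using (_⊎_; inj₁; inj₂)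
import Data.Sum as Sum
open import Data.Unit using (⊤; tt)
open import Function using (_∘′_; case_of_)
open import Relation.Nullary using (¬_; Dec; yes; no)
open import Relation.Nullary.Decidable using (_×-dec_; _⊎-dec_)
open import Relation.Binary.PropositionalEquality
  using (_≡_; _≢_; refl; sym; trans; cong; subst; subst₂; ≢-sym; setoid; module ≡-Reasoning)
open import Data.List.Relation.Binary.Permutation.Setoid.Properties (setoid ℕ) using (Unique-resp-↭)

private
  variable
    n u v w x y z p q : ℕ
    xs ys zs l : List ℕ
    K H : Graph

Unique-head : Unique (x ∷ xs) → y ∈ xs → x ≢ y
Unique-head (x∉xs ∷ _) = All.lookup x∉xs

Unique-++⁻ˡ : ∀ xs → Unique (xs ++ ys) → Unique xs
Unique-++⁻ˡ []       _          = []
Unique-++⁻ˡ (x ∷ xs) (x∉ ∷ !xs) = All.++⁻ˡ xs x∉ ∷ Unique-++⁻ˡ xs !xs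

Unique-++⁻ʳ : ∀ xs → Unique (xs ++ ys) → Unique ys
Unique-++⁻ʳ []       !ys        = !ys
Unique-++⁻ʳ (x ∷ xs) (_ ∷ !xs) = Unique-++⁻ʳ xs !xs

Unique-++-disjoint : ∀ xs → Unique (xs ++ ys) → x ∈ xs → y ∈ ys → x ≢ y
Unique-++-disjoint (_ ∷ xs) !xs (here refl) y∈ = Unique-head !xs (∈-++⁺ʳ xs y∈)
Unique-++-disjoint (_ ∷ xs) !xs (there x∈)  y∈ = Unique-++-disjoint xs (AllPairs.tail !xs) x∈ y∈

Unique-reverse : Unique xs → Unique (reverse xs)
Unique-reverse {xs} = Unique-resp-↭ (↭⇒↭ₛ (↭-sym (↭-reverse xs)))

++-∷≢[] : ∀ xs → xs ++ x ∷ ys ≢ []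
++-∷≢[] xs eq with ++-conicalʳ xs _ eq
... | ()

singleton≢infix : ∀ xs → x ∷ [] ≢ xs ++ u ∷ ys ++ v ∷ zs
singleton≢infix {ys = ys} [] eq = ++-∷≢[] ys (sym (proj₂ (∷-injective eq)))
singleton≢infix (_ ∷ xs)     eq = ++-∷≢[] xs (sym (proj₂ (∷-injective eq)))

nonempty-∈ : xs ≢ [] → ∃ λ x → x ∈ xs
nonempty-∈ {[]}    xs≢[] = ⊥-elim (xs≢[] refl)
nonempty-∈ {x ∷ _} _     = x , here refl

∈-path⁻ : ∀ l → x ∈ p ∷ l ++ q ∷ [] → x ≡ p ⊎ x ∈ l ⊎ x ≡ q
∈-path⁻ l (here refl) = inj₁ refl
∈-path⁻ l (there x∈) with ∈-++⁻ l x∈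
... | inj₁ x∈l         = inj₂ (inj₁ x∈l)
... | inj₂ (here refl) = inj₂ (inj₂ refl)

∈-path-end : ∀ l → q ∈ p ∷ l ++ q ∷ []
∈-path-end l = there (∈-++⁺ʳ l (here refl))

∈-path-inner : ∀ l → x ∈ l → x ∈ p ∷ l ++ q ∷ []
∈-path-inner l x∈ = there (∈-++⁺ˡ x∈)

reverse-path : ∀ l → reverse (p ∷ l ++ q ∷ []) ≡ q ∷ reverse l ++ p ∷ []
reverse-path {p} {q} l = begin
  reverse (p ∷ l ++ q ∷ [])  ≡⟨ reverse-++ (p ∷ l) (q ∷ []) ⟩
  q ∷ reverse (p ∷ l)        ≡⟨ cong (q ∷_) (unfold-reverse p l) ⟩
  q ∷ reverse l ++ p ∷ []    ∎
  where open ≡-Reasoning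

pairs-∷⁺ : (u , v) ∈ pairs xs → (u , v) ∈ pairs (x ∷ xs)
pairs-∷⁺ {xs = _ ∷ _} m = there m

pairs-++⁺ˡ : ∀ xs → (u , v) ∈ pairs xs → (u , v) ∈ pairs (xs ++ ys)
pairs-++⁺ˡ (_ ∷ _ ∷ _)  (here refl) = here refl
pairs-++⁺ˡ (_ ∷ y ∷ xs) (there m)   = there (pairs-++⁺ˡ (y ∷ xs) m)

pairs-++⁺ʳ : ∀ xs → (u , v) ∈ pairs ys → (u , v) ∈ pairs (xs ++ ys)
pairs-++⁺ʳ []       m = m
pairs-++⁺ʳ (_ ∷ xs) m = pairs-∷⁺ (pairs-++⁺ʳ xs m)

pairs-split : ∀ xs → (u , v) ∈ pairs xs → ∃₂ λ ys zs → xs ≡ ys ++ u ∷ v ∷ zs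
pairs-split (_ ∷ _ ∷ xs) (here refl) = [] , xs , refl
pairs-split (x ∷ y ∷ xs) (there m) with pairs-split (y ∷ xs) m
... | ys , zs , eq = x ∷ ys , zs , cong (x ∷_) eq

pairs-∈ˡ : ∀ xs → (u , v) ∈ pairs xs → u ∈ xs
pairs-∈ˡ (_ ∷ _ ∷ _)  (here refl) = here refl
pairs-∈ˡ (_ ∷ y ∷ xs) (there m)   = there (pairs-∈ˡ (y ∷ xs) m)

pairs-∈ʳ : (u , v) ∈ pairs (x ∷ xs) → v ∈ xs
pairs-∈ʳ {xs = _ ∷ _} (here refl) = here refl
pairs-∈ʳ {xs = _ ∷ _} (there m)   = there (pairs-∈ʳ m)

pairs-irreflexive : Unique xs → (x , x) ∉ pairs xs
pairs-irreflexive {_ ∷ _ ∷ _} !xs (here refl) = Unique-head !xs (here refl) refl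
pairs-irreflexive {_ ∷ _ ∷ _} !xs (there m)   = pairs-irreflexive (AllPairs.tail !xs) m

reverse-++-∷-∷ : ∀ xs → reverse (xs ++ u ∷ v ∷ ys) ≡ reverse ys ++ v ∷ u ∷ reverse xs
reverse-++-∷-∷ {u} {v} {ys} xs = begin
  reverse (xs ++ u ∷ v ∷ ys)                 ≡⟨ reverse-++ xs (u ∷ v ∷ ys) ⟩
  reverse (u ∷ v ∷ ys) ++ reverse xs         ≡⟨ cong (_++ reverse xs) (reverse-++ (u ∷ v ∷ []) ys) ⟩
  (reverse ys ++ v ∷ u ∷ []) ++ reverse xs   ≡⟨ ++-assoc (reverse ys) (v ∷ u ∷ []) (reverse xs) ⟩
  reverse ys ++ v ∷ u ∷ reverse xs           ∎
  where open ≡-Reasoning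

pairs-reverse : ∀ xs → (u , v) ∈ pairs xs → (v , u) ∈ pairs (reverse xs)
pairs-reverse xs m with pairs-split xs m
... | ys , zs , refl =
  subst (λ l → _ ∈ pairs l) (sym (reverse-++-∷-∷ ys)) (pairs-++⁺ʳ (reverse zs) (here refl))

PathEdge-map : (∀ {u v} → (u , v) ∈ pairs xs → (u , v) ∈ pairs ys) → PathEdge xs u v → PathEdge ys u v
PathEdge-map f = Sum.map f f

PathEdge-∈ : ∀ xs → PathEdge xs u v → u ∈ xs
PathEdge-∈ xs      (inj₁ m) = pairs-∈ˡ xs m
PathEdge-∈ (_ ∷ _) (inj₂ m) = there (pairs-∈ʳ m)

PathEdge-reverse : ∀ xs → PathEdge (reverse xs) u v → PathEdge xs u v
PathEdge-reverse xs (inj₁ m) = inj₂ (pairs-reverse⁻ m)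
  where
  pairs-reverse⁻ : (u , v) ∈ pairs (reverse xs) → (v , u) ∈ pairs xs
  pairs-reverse⁻ m = subst (λ l → _ ∈ pairs l) (reverse-involutive xs) (pairs-reverse _ m)
PathEdge-reverse xs (inj₂ m) = Sum.swap (PathEdge-reverse xs (inj₁ m))

PathEdge-infix : ∀ xs → PathEdge ys u v → PathEdge (xs ++ ys ++ zs) u v
PathEdge-infix {ys} xs = PathEdge-map (λ m → pairs-++⁺ʳ xs (pairs-++⁺ˡ ys m))

PathEdge-extend : ∀ xs → PathEdge xs u v → PathEdge (x ∷ xs ++ y ∷ []) u v
PathEdge-extend xs = PathEdge-map (λ m → pairs-∷⁺ (pairs-++⁺ˡ xs m))

PathEdge-tail : PathEdge (x ∷ y ∷ xs) u v → u ≢ x → u ≢ y → PathEdge (y ∷ xs) u v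
PathEdge-tail (inj₁ (here refl)) u≢x _   = ⊥-elim (u≢x refl)
PathEdge-tail (inj₁ (there m))   _   _   = inj₁ m
PathEdge-tail (inj₂ (here refl)) _   u≢y = ⊥-elim (u≢y refl)
PathEdge-tail (inj₂ (there m))   _   _   = inj₂ m

PathEdge-second : Unique (x ∷ y ∷ w ∷ xs) → PathEdge (x ∷ y ∷ w ∷ xs) y z → z ≡ x ⊎ z ≡ w
PathEdge-second !xs (inj₁ (here refl))         = ⊥-elim (Unique-head !xs (here refl) refl)
PathEdge-second _   (inj₁ (there (here refl))) = inj₂ refl
PathEdge-second !xs (inj₁ (there (there m)))   =
  ⊥-elim (Unique-head (AllPairs.tail !xs) (pairs-∈ˡ _ m) refl)
PathEdge-second _   (inj₂ (here refl))         = inj₁ refl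
PathEdge-second !xs (inj₂ (there (here refl))) = ⊥-elim (Unique-head (AllPairs.tail !xs) (here refl) refl)
PathEdge-second !xs (inj₂ (there (there m)))   =
  ⊥-elim (Unique-head (AllPairs.tail !xs) (there (pairs-∈ʳ m)) refl)

PathEdge-meets-interior : ∀ l → l ≢ [] → PathEdge (p ∷ l ++ q ∷ []) u v → u ∈ l ⊎ v ∈ l
PathEdge-meets-interior l l≢[] (inj₁ m) = pair-inner l l≢[] m
  where
  pair-inner : ∀ l → l ≢ [] → (u , v) ∈ pairs (p ∷ l ++ q ∷ []) → u ∈ l ⊎ v ∈ l
  pair-inner []          l≢[] _                  = ⊥-elim (l≢[] refl)
  pair-inner (_ ∷ _)     _    (here refl)        = inj₂ (here refl)
  pair-inner (_ ∷ [])    _    (there (here refl)) = inj₁ (here refl)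
  pair-inner (_ ∷ y ∷ l) _    (there m)          = Sum.map there there (pair-inner (y ∷ l) (λ ()) m)
PathEdge-meets-interior l l≢[] (inj₂ m) = Sum.swap (PathEdge-meets-interior l l≢[] (inj₁ m))

PathEdge? : ∀ xs u v → Dec (PathEdge xs u v)
PathEdge? xs u v = (u , v) ∈²? pairs xs ⊎-dec (v , u) ∈²? pairs xs

Before : ℕ → ℕ → List ℕ → Set
Before u v l = ∃₂ λ xs ys → ∃ λ zs → l ≡ xs ++ u ∷ ys ++ v ∷ zs

before-or-after : u ∈ l → v ∈ l → u ≢ v → Before u v l ⊎ Before v u l
before-or-after u∈ v∈ u≢v with ∈-∃++ u∈
... | xs , rs , refl with ∈-++⁻ xs v∈
...   | inj₂ (here v≡u)   = ⊥-elim (u≢v (sym v≡u))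
...   | inj₂ (there v∈rs) = let ys , zs , eq = ∈-∃++ v∈rs in
                            inj₁ (xs , ys , zs , cong (λ r → xs ++ _ ∷ r) eq)
...   | inj₁ v∈xs         = let xs₁ , xs₂ , eq = ∈-∃++ v∈xs in
                            inj₂ (xs₁ , xs₂ , rs , trans (cong (_++ _) eq) (++-assoc xs₁ _ _))

infix-assoc : ∀ xs → xs ++ u ∷ ys ++ v ∷ zs ≡ xs ++ (u ∷ ys ++ v ∷ []) ++ zs
infix-assoc {u} {ys} {v} {zs} xs = cong (λ r → xs ++ u ∷ r) (sym (++-assoc ys (v ∷ []) zs))

infix-⊆ : ∀ xs → l ≡ xs ++ u ∷ ys ++ v ∷ zs → (u ∷ ys ++ v ∷ []) ⊆ l
infix-⊆ {zs = zs} xs eq w∈ = subst (_ ∈_) (sym (trans eq (infix-assoc xs))) (∈-++⁺ʳ xs (∈-++⁺ˡ w∈))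

PathIn : Graph → List ℕ → Set
PathIn K xs = ∀ {u v} → PathEdge xs u v → E K u v

next : List ℕ → ℕ → ℕ
next []      q = q
next (y ∷ _) _ = y

last : ℕ → List ℕ → ℕ
last p []       = p
last _ (y ∷ xs) = last y xs

PathEdge-neighbours : ∀ l → Unique (x ∷ y ∷ l ++ q ∷ []) → PathEdge (x ∷ y ∷ l ++ q ∷ []) y z →
                      z ≡ x ⊎ z ≡ next l q
PathEdge-neighbours []      = PathEdge-second
PathEdge-neighbours (_ ∷ _) = PathEdge-second

AdjacentOnlyTo : Graph → ℕ → ℕ → ℕ → Set
AdjacentOnlyTo K y u v = ∀ {z} → E K y z → z ≡ u ⊎ z ≡ v

Bare : Graph → ℕ → List ℕ → ℕ → Set
Bare K p []       q = ⊤
Bare K p (y ∷ xs) q = V K y × AdjacentOnlyTo K y p (next xs q) × Bare K y xs q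

record BarePath (K : Graph) (p : ℕ) (l : List ℕ) (q : ℕ) : Set where
  field
    unique : Unique (p ∷ l ++ q ∷ [])
    edges  : PathIn K (p ∷ l ++ q ∷ [])
    bare   : Bare K p l q

Bare-mono : ∀ {K₁ K₂} → (∀ {y} → V K₁ y → V K₂ y) → (∀ {y z} → y ∈ l → E K₂ y z → E K₁ y z) →
            Bare K₁ p l q → Bare K₂ p l q
Bare-mono {l = []}    _  _  _                  = tt
Bare-mono {l = _ ∷ _} V⊆ E⊇ (yV , adj , bare) =
  V⊆ yV , (λ e → adj (E⊇ (here refl) e)) , Bare-mono V⊆ (λ y∈ → E⊇ (there y∈)) bare

Bare-V : Bare K p l q → y ∈ l → V K y
Bare-V (yV , _ , _)   (here refl) = yV
Bare-V (_ , _ , bare) (there y∈)  = Bare-V bare y∈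

next-∈ : ∀ l → next l q ∈ l ++ q ∷ []
next-∈ []      = here refl
next-∈ (_ ∷ _) = here refl

Bare-neighbour : Bare K p l q → y ∈ l → E K y z → z ∈ p ∷ l ++ q ∷ []
Bare-neighbour {l = _ ∷ l} (_ , adj , _) (here refl) e with adj e
... | inj₁ refl = here refl
... | inj₂ refl = there (there (next-∈ l))
Bare-neighbour (_ , _ , bare) (there y∈) e = there (Bare-neighbour bare y∈ e)

Bare-from-path : Unique (p ∷ l ++ q ∷ []) → (∀ {y} → y ∈ l → V K y) →
                 (∀ {y z} → y ∈ l → E K y z → PathEdge (p ∷ l ++ q ∷ []) y z) → Bare K p l q
Bare-from-path {l = []}    _     _   _  = tt
Bare-from-path {l = _ ∷ l} !path V∈l E⊆ =
  V∈l (here refl) ,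
  (λ e → PathEdge-neighbours l !path (E⊆ (here refl) e)) ,
  Bare-from-path (AllPairs.tail !path) (λ y∈ → V∈l (there y∈))
    (λ y∈ e → PathEdge-tail (E⊆ (there y∈) e)
                (λ y≡p → Unique-head !path (there (∈-++⁺ˡ y∈)) (sym y≡p))
                (λ y≡ → Unique-head (AllPairs.tail !path) (∈-++⁺ˡ y∈) (sym y≡)))

next-≡ : ∀ xs ys → xs ++ q ∷ [] ≡ ys ++ p ∷ zs → next xs q ≡ next ys p
next-≡ []      []      eq = proj₁ (∷-injective eq)
next-≡ []      (_ ∷ _) eq = proj₁ (∷-injective eq)
next-≡ (_ ∷ _) []      eq = proj₁ (∷-injective eq)
next-≡ (_ ∷ _) (_ ∷ _) eq = proj₁ (∷-injective eq)

Bare-prefix : ∀ xs ys → xs ++ q ∷ [] ≡ ys ++ p ∷ zs → Bare K x xs q → Bare K x ys p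
Bare-prefix _        []       _  _ = tt
Bare-prefix []       (_ ∷ ys) eq _ = ⊥-elim (++-∷≢[] ys (sym (proj₂ (∷-injective eq))))
Bare-prefix {K = K} {x = x} (y ∷ xs) (_ ∷ ys) eq (yV , adj , bare) with ∷-injective eq
... | refl , eq′ = yV , subst (AdjacentOnlyTo K y x) (next-≡ xs ys eq′) adj , Bare-prefix xs ys eq′ bare

Bare-infix : ∀ xs ys → p ∷ l ++ q ∷ [] ≡ xs ++ u ∷ ys ++ v ∷ zs → Bare K p l q → Bare K u ys v
Bare-infix [] ys eq bare with ∷-injective eq
... | refl , eq′ = Bare-prefix _ ys eq′ bare
Bare-infix {l = []}    (_ ∷ xs) ys eq _ = ⊥-elim (singleton≢infix xs (proj₂ (∷-injective eq)))
Bare-infix {l = _ ∷ _} (_ ∷ xs) ys eq (_ , _ , bare) = Bare-infix xs ys (proj₂ (∷-injective eq)) bare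

next-∷ʳ : ∀ xs → next xs y ≡ next (xs ++ y ∷ []) q
next-∷ʳ []      = refl
next-∷ʳ (_ ∷ _) = refl

Bare-∷ʳ : ∀ xs → Bare K p xs y → V K y → AdjacentOnlyTo K y (last p xs) q → Bare K p (xs ++ y ∷ []) q
Bare-∷ʳ []                _                  yV adj = yV , adj , tt
Bare-∷ʳ {K = K} {p = p} (x ∷ xs) (xV , xadj , bare) yV adj =
  xV , subst (AdjacentOnlyTo K x p) (next-∷ʳ xs) xadj , Bare-∷ʳ xs bare yV adj

last-∷ʳ : ∀ xs → last p (xs ++ y ∷ []) ≡ y
last-∷ʳ []       = refl
last-∷ʳ (_ ∷ xs) = last-∷ʳ xs

last-reverse : ∀ xs → last q (reverse xs) ≡ next xs q
last-reverse []       = refl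
last-reverse (x ∷ xs) = trans (cong (last _) (unfold-reverse x xs)) (last-∷ʳ (reverse xs))

Bare-reverse : ∀ l → Bare K p l q → Bare K q (reverse l) p
Bare-reverse []                    _                 = tt
Bare-reverse {K = K} {p} {q} (y ∷ l) (yV , adj , bare) =
  subst (λ r → Bare K q r p) (sym (unfold-reverse y l))
    (Bare-∷ʳ (reverse l) (Bare-reverse l bare) yV
      (λ e → Sum.map₁ (λ z≡ → trans z≡ (sym (last-reverse l))) (Sum.swap (adj e))))

BarePath-reverse : BarePath K p l q → BarePath K q (reverse l) p
BarePath-reverse {l = l} π = record
  { unique = subst Unique (reverse-path l) (Unique-reverse unique)
  ; edges  = λ e → edges (PathEdge-reverse _ (subst (λ r → PathEdge r _ _) (sym (reverse-path l)) e))
  ; bare   = Bare-reverse l bare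
  }
  where open BarePath π

BarePath-infix : ∀ xs ys → p ∷ l ++ q ∷ [] ≡ xs ++ u ∷ ys ++ v ∷ zs → BarePath K p l q → BarePath K u ys v
BarePath-infix {p = p} {l = l} {q = q} {u = u} {v = v} {zs = zs} xs ys eq π = record
  { unique = Unique-++⁻ˡ (u ∷ ys ++ v ∷ []) (Unique-++⁻ʳ xs (subst Unique eq′ unique))
  ; edges  = λ e → edges (subst (λ r → PathEdge r _ _) (sym eq′) (PathEdge-infix xs e))
  ; bare   = Bare-infix xs ys eq bare
  }
  where
  open BarePath π
  eq′ : p ∷ l ++ q ∷ [] ≡ xs ++ (u ∷ ys ++ v ∷ []) ++ zs
  eq′ = trans eq (infix-assoc xs)

barePath-between : BarePath K p l q → u ∈ p ∷ l ++ q ∷ [] → v ∈ p ∷ l ++ q ∷ [] → u ≢ v →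
                   ∃ λ ys → BarePath K u ys v × (u ∷ ys ++ v ∷ []) ⊆ (p ∷ l ++ q ∷ [])
barePath-between π u∈ v∈ u≢v with before-or-after u∈ v∈ u≢v
... | inj₁ (xs , ys , zs , eq) = ys , BarePath-infix xs ys eq π , infix-⊆ xs eq
... | inj₂ (xs , ys , zs , eq) =
  reverse ys , BarePath-reverse (BarePath-infix xs ys eq π) ,
  λ w∈ → infix-⊆ xs eq (Any.reverse⁻ (subst (_ ∈_) (sym (reverse-path ys)) w∈))

⊕-barePath : (∀ {u v} → E H u v → V H u) → (P : Ear H) → BarePath (H ⊕ P) (start P) (inner P) (end P)
⊕-barePath {H} E-V P = record
  { unique = distinct P
  ; edges  = inj₂
  ; bare   = Bare-from-path (distinct P) (λ y∈ → inj₂ (there (∈-++⁺ˡ y∈))) inner-edges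
  }
  where
  inner-edges : y ∈ inner P → E (H ⊕ P) y z → PathEdge (verts P) y z
  inner-edges y∈ (inj₁ e)  = ⊥-elim (All.lookup (innerOut P) y∈ (E-V e))
  inner-edges _  (inj₂ pe) = pe

BarePath-≅ : K ≅ H → BarePath H p l q → BarePath K p l q
BarePath-≅ K≅H π = record
  { unique = unique
  ; edges  = λ e → proj₂ (E-iff _ _) (edges e)
  ; bare   = Bare-mono (λ {y} → proj₂ (V-iff y)) (λ {y} {z} _ → proj₁ (E-iff y z)) bare
  }
  where
  open BarePath π
  open _≅_ K≅H

EvenLength : List ℕ → Set
EvenLength []           = ⊤
EvenLength (_ ∷ [])     = ⊥
EvenLength (_ ∷ _ ∷ xs) = EvenLength xs

EvenLength-++ : ∀ xs → EvenLength xs → EvenLength ys → EvenLength (xs ++ ys)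
EvenLength-++ []           _   ev = ev
EvenLength-++ (_ ∷ _ ∷ xs) exs ev = EvenLength-++ xs exs ev

EvenLength-path : ∀ xs → EvenLength xs → EvenLength (x ∷ xs ++ y ∷ [])
EvenLength-path []           _  = tt
EvenLength-path (_ ∷ _ ∷ xs) ev = EvenLength-path xs ev

length-even : ∀ xs k → length xs ≡ k + k → EvenLength xs
length-even []           _       _  = tt
length-even (_ ∷ [])     zero    ()
length-even (_ ∷ [])     (suc k) eq with trans (suc-injective eq) (+-suc k k)
... | ()
length-even (_ ∷ _ ∷ _)  zero    ()
length-even (_ ∷ _ ∷ xs) (suc k) eq = length-even xs k (suc-injective (trans (suc-injective eq) (+-suc k k)))

PathMatching : List ℕ → ℕ → ℕ → Set
PathMatching (x ∷ y ∷ xs) u v = (u ≡ x × v ≡ y) ⊎ (u ≡ y × v ≡ x) ⊎ PathMatching xs u v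
PathMatching _            _ _ = ⊥

PathMatching-sym : ∀ xs → PathMatching xs u v → PathMatching xs v u
PathMatching-sym (_ ∷ _ ∷ _)  (inj₁ (refl , refl))        = inj₂ (inj₁ (refl , refl))
PathMatching-sym (_ ∷ _ ∷ _)  (inj₂ (inj₁ (refl , refl))) = inj₁ (refl , refl)
PathMatching-sym (_ ∷ _ ∷ xs) (inj₂ (inj₂ m))             = inj₂ (inj₂ (PathMatching-sym xs m))

PathMatching-∈ : ∀ xs → PathMatching xs u v → u ∈ xs
PathMatching-∈ (_ ∷ _ ∷ _)  (inj₁ (refl , _))        = here refl
PathMatching-∈ (_ ∷ _ ∷ _)  (inj₂ (inj₁ (refl , _))) = there (here refl)
PathMatching-∈ (_ ∷ _ ∷ xs) (inj₂ (inj₂ m))          = there (there (PathMatching-∈ xs m))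

PathMatching⊆PathEdge : ∀ xs → PathMatching xs u v → PathEdge xs u v
PathMatching⊆PathEdge (_ ∷ _ ∷ _)  (inj₁ (refl , refl))        = inj₁ (here refl)
PathMatching⊆PathEdge (_ ∷ _ ∷ _)  (inj₂ (inj₁ (refl , refl))) = inj₂ (here refl)
PathMatching⊆PathEdge (_ ∷ y ∷ xs) (inj₂ (inj₂ m))             =
  PathEdge-map (λ m′ → there (pairs-∷⁺ m′)) (PathMatching⊆PathEdge xs m)

PathMatching-partner : ∀ xs → EvenLength xs → u ∈ xs → ∃ (PathMatching xs u)
PathMatching-partner (_ ∷ y ∷ _)  _  (here refl)         = y , inj₁ (refl , refl)
PathMatching-partner (x ∷ _ ∷ _)  _  (there (here refl)) = x , inj₂ (inj₁ (refl , refl))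
PathMatching-partner (_ ∷ _ ∷ xs) ev (there (there u∈))  =
  let v , m = PathMatching-partner xs ev u∈ in v , inj₂ (inj₂ m)

PathMatching-unique : ∀ xs → Unique xs → PathMatching xs u v → PathMatching xs u w → v ≡ w
PathMatching-unique (_ ∷ _ ∷ xs) !xs (inj₁ (refl , refl)) m′ with m′
... | inj₁ (_ , refl)        = refl
... | inj₂ (inj₁ (u≡y , _)) = ⊥-elim (Unique-head !xs (here refl) u≡y)
... | inj₂ (inj₂ m″)         = ⊥-elim (Unique-head !xs (there (PathMatching-∈ xs m″)) refl)
PathMatching-unique (_ ∷ _ ∷ xs) !xs (inj₂ (inj₁ (refl , refl))) m′ with m′
... | inj₁ (u≡x , _)         = ⊥-elim (Unique-head !xs (here refl) (sym u≡x))
... | inj₂ (inj₁ (_ , refl)) = refl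
... | inj₂ (inj₂ m″)         = ⊥-elim (Unique-head (AllPairs.tail !xs) (PathMatching-∈ xs m″) refl)
PathMatching-unique (_ ∷ _ ∷ xs) !xs (inj₂ (inj₂ m)) m′ with m′
... | inj₁ (refl , _)        = ⊥-elim (Unique-head !xs (there (PathMatching-∈ xs m)) refl)
... | inj₂ (inj₁ (refl , _)) = ⊥-elim (Unique-head (AllPairs.tail !xs) (PathMatching-∈ xs m) refl)
... | inj₂ (inj₂ m″)         = PathMatching-unique xs (AllPairs.tail (AllPairs.tail !xs)) m m″

PathMatching-++⁻ : ∀ xs → EvenLength xs → PathMatching (xs ++ ys) u v →
                   PathMatching xs u v ⊎ PathMatching ys u v
PathMatching-++⁻ []           _  m               = inj₂ m
PathMatching-++⁻ (_ ∷ _ ∷ _)  _  (inj₁ e)        = inj₁ (inj₁ e)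
PathMatching-++⁻ (_ ∷ _ ∷ _)  _  (inj₂ (inj₁ e)) = inj₁ (inj₂ (inj₁ e))
PathMatching-++⁻ (_ ∷ _ ∷ xs) ev (inj₂ (inj₂ m)) = Sum.map₁ (λ m′ → inj₂ (inj₂ m′)) (PathMatching-++⁻ xs ev m)

PathMatching-++⁺ʳ : ∀ xs → EvenLength xs → PathMatching ys u v → PathMatching (xs ++ ys) u v
PathMatching-++⁺ʳ []           _  m = m
PathMatching-++⁺ʳ (_ ∷ _ ∷ xs) ev m = inj₂ (inj₂ (PathMatching-++⁺ʳ xs ev m))

pairs-matchings : ∀ xs → (u , v) ∈ pairs (x ∷ xs) → PathMatching (x ∷ xs) u v ⊎ PathMatching xs u v
pairs-matchings (_ ∷ _)  (here refl) = inj₁ (inj₁ (refl , refl))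
pairs-matchings (_ ∷ xs) (there m) with pairs-matchings xs m
... | inj₁ m′ = inj₂ m′
... | inj₂ m′ = inj₁ (inj₂ (inj₂ m′))

PathEdge-matchings : ∀ xs → PathEdge (x ∷ xs) u v → PathMatching (x ∷ xs) u v ⊎ PathMatching xs u v
PathEdge-matchings xs (inj₁ m) = pairs-matchings xs m
PathEdge-matchings xs (inj₂ m) =
  Sum.map (PathMatching-sym (_ ∷ xs)) (PathMatching-sym xs) (pairs-matchings xs m)

PathMatching? : ∀ xs u v → Dec (PathMatching xs u v)
PathMatching? []           _ _ = no λ ()
PathMatching? (_ ∷ [])     _ _ = no λ ()
PathMatching? (x ∷ y ∷ xs) u v =
  (u ≟ x ×-dec v ≟ y) ⊎-dec (u ≟ y ×-dec v ≟ x) ⊎-dec PathMatching? xs u v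

PairsUp : (ℕ → ℕ → Set) → List ℕ → Set
PairsUp M []           = ⊤
PairsUp M (_ ∷ [])     = ⊥
PairsUp M (x ∷ y ∷ xs) = M x y × PairsUp M xs

module _ {M : ℕ → ℕ → Set} where

  PairsUp-++ : ∀ xs → PairsUp M xs → PairsUp M ys → PairsUp M (xs ++ ys)
  PairsUp-++ []           _          pys = pys
  PairsUp-++ (_ ∷ _ ∷ xs) (m , pxs) pys = m , PairsUp-++ xs pxs pys

  PairsUp-even : ∀ xs → PairsUp M xs → EvenLength xs
  PairsUp-even []           _         = tt
  PairsUp-even (_ ∷ _ ∷ xs) (_ , pxs) = PairsUp-even xs pxs

  PairsUp-PathMatching : (∀ {u v} → M u v → M v u) → ∀ xs → PairsUp M xs → PathMatching xs u v → M u v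
  PairsUp-PathMatching _     (_ ∷ _ ∷ _)  (m , _)   (inj₁ (refl , refl))        = m
  PairsUp-PathMatching M-sym (_ ∷ _ ∷ _)  (m , _)   (inj₂ (inj₁ (refl , refl))) = M-sym m
  PairsUp-PathMatching M-sym (_ ∷ _ ∷ xs) (_ , pxs) (inj₂ (inj₂ uv))            =
    PairsUp-PathMatching M-sym xs pxs uv

module _ {K : Graph} {M : ℕ → ℕ → Set} (pm : PerfectMatching K M) where
  open PerfectMatching pm

  partner-unique : V K v → M v u → M v w → u ≡ w
  partner-unique vV Mvu Mvw = let _ , _ , only = cover _ vV in trans (only _ Mvu) (sym (only _ Mvw))

  PairsUp-partner : ∀ xs → PairsUp M xs → u ∈ xs → V K u → M u v → PathMatching xs u v
  PairsUp-partner xs pxs u∈ uV Muv =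
    let w , uw = PathMatching-partner xs (PairsUp-even xs pxs) u∈ in
    subst (PathMatching xs _) (partner-unique uV (PairsUp-PathMatching M-sym xs pxs uw) Muv) uw

  PairsUp-closed : ∀ xs → PairsUp M xs → u ∈ xs → V K u → M u v → v ∈ xs
  PairsUp-closed xs pxs u∈ uV Muv = PathMatching-∈ xs (PathMatching-sym xs (PairsUp-partner xs pxs u∈ uV Muv))

  matched-forward : V K y → AdjacentOnlyTo K y x z → ¬ M y x → M y z
  matched-forward yV adj ¬Myx with cover _ yV
  ... | w , Myw , _ with adj (M⊆E Myw)
  ...   | inj₁ refl = ⊥-elim (¬Myx Myw)
  ...   | inj₂ refl = Myw

  not-matched-back : V K y → M x y → x ≢ z → ¬ M z y
  not-matched-back yV Mxy x≢z Mzy = x≢z (partner-unique yV (M-sym Mxy) (M-sym Mzy))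

  pairsUp-interior : ∀ l → Unique (p ∷ x ∷ l ++ q ∷ []) → Bare K p (x ∷ l) q → EvenLength (x ∷ l) →
                     ¬ M x p → PairsUp M (x ∷ l)
  pairsUp-interior (_ ∷ [])    _     (xV , adj , _)              _  ¬Mxp = matched-forward xV adj ¬Mxp , tt
  pairsUp-interior {x = x} (y ∷ _ ∷ l) !path (xV , adj , yV , _ , bare) ev ¬Mxp =
    Mxy , pairsUp-interior l (AllPairs.tail (AllPairs.tail !path)) bare ev
            (not-matched-back yV Mxy (Unique-head (AllPairs.tail !path) (there (here refl))))
    where
    Mxy : M x y
    Mxy = matched-forward xV adj ¬Mxp

  pairsUp-to-end : ∀ l → Unique (p ∷ x ∷ l ++ q ∷ []) → Bare K p (x ∷ l) q → EvenLength l →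
                   ¬ M x p → PairsUp M (x ∷ l ++ q ∷ [])
  pairsUp-to-end []          _     (xV , adj , _)              _  ¬Mxp = matched-forward xV adj ¬Mxp , tt
  pairsUp-to-end {x = x} (y ∷ _ ∷ l) !path (xV , adj , yV , _ , bare) ev ¬Mxp =
    Mxy , pairsUp-to-end l (AllPairs.tail (AllPairs.tail !path)) bare ev
            (not-matched-back yV Mxy (Unique-head (AllPairs.tail !path) (there (here refl))))
    where
    Mxy : M x y
    Mxy = matched-forward xV adj ¬Mxp

  pairsUp-path : M p x → ∀ l → Unique (p ∷ x ∷ l ++ q ∷ []) → Bare K p (x ∷ l) q → EvenLength (x ∷ l) →
                 PairsUp M (p ∷ x ∷ l ++ q ∷ [])
  pairsUp-path Mpx (_ ∷ l) !path (xV , _ , bare) ev =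
    Mpx , pairsUp-to-end l (AllPairs.tail !path) bare ev
            (not-matched-back xV Mpx (Unique-head !path (there (here refl))))

  pairsUp-path-or-interior : V K p → Unique (p ∷ l ++ q ∷ []) → Bare K p l q → EvenLength l →
                             PairsUp M (p ∷ l ++ q ∷ []) ⊎ PairsUp M l
  pairsUp-path-or-interior {l = []}    _  _     _    _  = inj₂ tt
  pairsUp-path-or-interior {l = x ∷ l} pV !path bare ev with cover _ pV
  ... | w , Mpw , _ with w ≟ x
  ...   | yes refl = inj₁ (pairsUp-path Mpw l !path bare ev)
  ...   | no w≢x   = inj₂ (pairsUp-interior l !path bare ev (λ Mxp → w≢x (partner-unique pV Mpw (M-sym Mxp))))

  pairsUp-interior-if-leaves : V K p → Unique (p ∷ l ++ q ∷ []) → Bare K p l q → EvenLength l →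
                               y ∈ p ∷ l ++ q ∷ [] → V K y → M y w → w ∉ p ∷ l ++ q ∷ [] → PairsUp M l
  pairsUp-interior-if-leaves pV !path bare ev y∈ yV Myw w∉ with pairsUp-path-or-interior pV !path bare ev
  ... | inj₁ ppath = ⊥-elim (w∉ (PairsUp-closed _ ppath y∈ yV Myw))
  ... | inj₂ pl    = pl

Splice : (ℕ → ℕ → Set) → List ℕ → List ℕ → ℕ → ℕ → Set
Splice M xs ys u v = (M u v × u ∉ xs × v ∉ xs) ⊎ PathMatching ys u v

splice-perfect : ∀ {K₁ K₂ M} → IsGraph K₁ → PerfectMatching K₁ M → PairsUp M xs →
  Unique ys → EvenLength ys →
  (∀ {v} → V K₂ v → v ∉ ys → V K₁ v × v ∉ xs) →
  (∀ {v} → V K₁ v → v ∉ xs → v ∉ ys) →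
  (∀ {u v} → M u v → u ∉ xs → v ∉ xs → E K₂ u v) →
  (∀ {u v} → PathMatching ys u v → E K₂ u v) →
  PerfectMatching K₂ (Splice M xs ys)
splice-perfect {xs} {ys} {K₁} {K₂} {M} gK₁ pm pxs !ys eys new-vertex old-vertex old-edge new-edge = record
  { M⊆E   = λ { (inj₁ (Muv , u∉ , v∉)) → old-edge Muv u∉ v∉ ; (inj₂ uv) → new-edge uv }
  ; M-sym = λ { (inj₁ (Muv , u∉ , v∉)) → inj₁ (M-sym Muv , v∉ , u∉)
              ; (inj₂ uv)               → inj₂ (PathMatching-sym ys uv) }
  ; cover = cover′
  }
  where
  open PerfectMatching pm
  cover′ : ∀ v → V K₂ v → ∃ λ u → Splice M xs ys v u × (∀ w → Splice M xs ys v w → w ≡ u)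
  cover′ v vV with v ∈? ys
  ... | yes v∈ =
    let u , vu = PathMatching-partner ys eys v∈ in
    u , inj₂ vu ,
    λ { _ (inj₁ (Mvw , v∉xs , _)) → ⊥-elim (old-vertex (E-V gK₁ (M⊆E Mvw)) v∉xs v∈)
      ; _ (inj₂ vw)               → PathMatching-unique ys !ys vw vu }
  ... | no v∉ =
    let vV₁ , v∉xs = new-vertex vV v∉
        u , Mvu , _ = cover v vV₁
        u∉xs = λ u∈ → v∉xs (PairsUp-closed pm xs pxs u∈ (E-V gK₁ (M⊆E (M-sym Mvu))) (M-sym Mvu))
    in
    u , inj₁ (Mvu , v∉xs , u∉xs) ,
    λ { _ (inj₁ (Mvw , _)) → partner-unique pm vV₁ Mvw Mvu
      ; _ (inj₂ vw)        → ⊥-elim (v∉ (PathMatching-∈ ys vw)) }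

_◅◅_ : Walk K u v → Walk K v w → Walk K u w
here       ◅◅ q = q
step e p ◅◅ q = step e (p ◅◅ q)

walk-reverse : (∀ {u v} → E K u v → E K v u) → Walk K u v → Walk K v u
walk-reverse E-sym here       = here
walk-reverse E-sym (step e p) = walk-reverse E-sym p ◅◅ step (E-sym e) here

walk-map : ∀ {K₁ K₂} (f : ℕ → ℕ) → (∀ {a b} → E K₁ a b → Walk K₂ (f a) (f b)) →
           Walk K₁ u v → Walk K₂ (f u) (f v)
walk-map f g here       = here
walk-map f g (step e p) = g e ◅◅ walk-map f g p

walk-along : PathIn K (x ∷ xs) → y ∈ x ∷ xs → Walk K x y
walk-along             _    (here refl)  = here
walk-along {xs = _ ∷ _} path (there y∈) =
  step (path (inj₁ (here refl))) (walk-along (λ e → path (PathEdge-map there e)) y∈)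

walk-crossing : ∀ xs → Walk K u v → u ∉ xs → v ∈ xs → ∃₂ λ w y → E K w y × w ∉ xs × y ∈ xs
walk-crossing xs here u∉ v∈ = ⊥-elim (u∉ v∈)
walk-crossing xs (step {w = y} e p) u∉ v∈ with y ∈? xs
... | yes y∈ = _ , _ , e , u∉ , y∈
... | no  y∉ = walk-crossing xs p y∉ v∈

walk-into-pendant : (∀ {u v} → E K u v → E K v u) → (∀ {z} → E K x z → z ≡ w) →
                    Walk K u x → u ≢ x → u ≢ w → ∃ λ z → E K z w × z ≢ x
walk-into-pendant _ _ here u≢x _ = ⊥-elim (u≢x refl)
walk-into-pendant {x = x} {w = w} E-sym only (step {w = y} e p) u≢x u≢w with y ≟ x | y ≟ w
... | yes refl | _        = ⊥-elim (u≢w (only (E-sym e)))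
... | no  _    | yes refl = _ , e , u≢x
... | no  y≢x  | no  y≢w  = walk-into-pendant E-sym only p y≢x y≢w

no-pendant : IsGraph K → MatchingCovered K → V K x → (∀ {z} → E K x z → z ≡ w) →
             V K u → u ≢ x → u ≢ w → ⊥
no-pendant gK (connected , _ , covered) xV only uV u≢x u≢w =
  let z , Ezw , z≢x = walk-into-pendant (E-sym gK) only (connected _ _ uV xV) u≢x u≢w
      M , pm , Mzw  = covered _ _ Ezw
      open PerfectMatching pm
      y , Mxy , _   = cover _ xV
      Mxw           = subst (M _) (only (M⊆E Mxy)) Mxy
  in z≢x (partner-unique pm (E-V gK (E-sym gK (M⊆E Mxw))) (M-sym Mzw) (M-sym Mxw))

edge-flip : (x ≡ u × y ≡ v) ⊎ (x ≡ v × y ≡ u) → (y ≡ u × x ≡ v) ⊎ (y ≡ v × x ≡ u)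
edge-flip = Sum.swap ∘′ Sum.map Product.swap Product.swap

-edge-isGraph : IsGraph K → IsGraph (K -edge (u , v))
-edge-isGraph gK = record
  { E-sym  = λ (e , ¬uv) → E-sym gK e , λ uv → ¬uv (edge-flip uv)
  ; E-irr  = λ (e , _) → E-irr gK e
  ; E-V    = λ (e , _) → E-V gK e
  ; finite = finite gK
  }

module _ {K : Graph} {u v : ℕ} (gK : IsGraph K) (mc : MatchingCovered (K -edge (u , v))) where

  bare-pair-essential : Unique (p ∷ l ++ q ∷ []) → l ≢ [] → V K p → V K q → Bare K p l q →
                        (x , y) ∈ pairs (p ∷ l ++ q ∷ []) → (x ≡ u × y ≡ v) ⊎ (x ≡ v × y ≡ u) → ⊥
  bare-pair-essential {l = []} _ l≢[] = ⊥-elim (l≢[] refl)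
  bare-pair-essential {p} {x ∷ l} {q} !path _ pV _ (xV , adj , _) (here refl) px =
    no-pendant (-edge-isGraph gK) mc xV only pV
      (Unique-head !path (here refl)) (Unique-head !path (there (next-∈ l)))
    where
    only : ∀ {z} → E (K -edge (u , v)) x z → z ≡ next l q
    only (e , ¬xz) with adj e
    ... | inj₁ refl = ⊥-elim (¬xz (edge-flip px))
    ... | inj₂ z≡   = z≡
  bare-pair-essential {p} {x ∷ []} !path _ _ qV (xV , adj , _) (there (here refl)) xq =
    no-pendant (-edge-isGraph gK) mc xV only qV
      (≢-sym (Unique-head (AllPairs.tail !path) (here refl))) (≢-sym (Unique-head !path (there (here refl))))
    where
    only : ∀ {z} → E (K -edge (u , v)) x z → z ≡ p
    only (e , ¬xz) with adj e
    ... | inj₁ z≡   = z≡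
    ... | inj₂ refl = ⊥-elim (¬xz xq)
  bare-pair-essential {l = _ ∷ []}    _     _ _ _  _                (there (there ())) _
  bare-pair-essential {l = _ ∷ _ ∷ _} !path _ _ qV (xV , _ , bare) (there m)          xy =
    bare-pair-essential (AllPairs.tail !path) (λ ()) xV qV bare m xy

  bare-edge-essential : Unique (p ∷ l ++ q ∷ []) → l ≢ [] → V K p → V K q → Bare K p l q →
                        ¬ PathEdge (p ∷ l ++ q ∷ []) u v
  bare-edge-essential !path l≢[] pV qV bare (inj₁ m) =
    bare-pair-essential !path l≢[] pV qV bare m (inj₁ (refl , refl))
  bare-edge-essential !path l≢[] pV qV bare (inj₂ m) =
    bare-pair-essential !path l≢[] pV qV bare m (inj₂ (refl , refl))

Ear-even : (P : Ear H) → EvenLength (inner P)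
Ear-even P = let k , eq = oddLength P in length-even (inner P) k eq

∈⇒≤sum : ∀ xs → x ∈ xs → x ≤ sum xs
∈⇒≤sum (y ∷ xs) (here refl) = m≤m+n y (sum xs)
∈⇒≤sum (y ∷ xs) (there x∈)  = ≤-trans (∈⇒≤sum xs x∈) (m≤n+m (sum xs) y)

⊕-isGraph : IsGraph H → (P : Ear H) → IsGraph (H ⊕ P)
⊕-isGraph gH P = record
  { E-sym  = λ { (inj₁ e) → inj₁ (E-sym gH e) ; (inj₂ pe) → inj₂ (Sum.swap pe) }
  ; E-irr  = λ { (inj₁ e) → E-irr gH e ; (inj₂ pe) → loop-free pe }
  ; E-V    = λ { (inj₁ e) → inj₁ (E-V gH e) ; (inj₂ pe) → inj₂ (PathEdge-∈ (verts P) pe) }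
  ; finite = let N , bound = finite gH in
             N + suc (sum (verts P)) ,
             λ { (inj₁ xV) → <-≤-trans (bound xV) (m≤m+n N _)
               ; (inj₂ x∈) → ≤-<-trans (∈⇒≤sum (verts P) x∈) (<-≤-trans (n<1+n _) (m≤n+m _ N)) }
  }
  where
  loop-free : ¬ PathEdge (verts P) x x
  loop-free (inj₁ m) = pairs-irreflexive (distinct P) m
  loop-free (inj₂ m) = pairs-irreflexive (distinct P) m

alternating : Bool → List ℕ → ℕ → Bool
alternating b []       _ = b
alternating b (y ∷ xs) x with x ≟ y
... | yes _ = b
... | no  _ = alternating (not b) xs x

alternating-head : ∀ b x xs → alternating b (x ∷ xs) x ≡ b
alternating-head b x xs with x ≟ x
... | yes _   = refl
... | no  x≢x = ⊥-elim (x≢x refl)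

alternating-tail : ∀ b x xs → x ≢ y → alternating b (y ∷ xs) x ≡ alternating (not b) xs x
alternating-tail {y} b x xs x≢y with x ≟ y
... | yes x≡y = ⊥-elim (x≢y x≡y)
... | no  _   = refl

alternating-pairs : ∀ b xs → Unique xs → (u , v) ∈ pairs xs → alternating b xs u ≢ alternating b xs v
alternating-pairs b (y ∷ z ∷ xs) !xs (here refl) eq =
  not-¬ refl (begin
    b                              ≡⟨ sym (alternating-head b y (z ∷ xs)) ⟩
    alternating b (y ∷ z ∷ xs) y   ≡⟨ eq ⟩
    alternating b (y ∷ z ∷ xs) z   ≡⟨ alternating-tail b z (z ∷ xs) (≢-sym (Unique-head !xs (here refl))) ⟩
    alternating (not b) (z ∷ xs) z ≡⟨ alternating-head (not b) z xs ⟩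
    not b                          ∎)
  where open ≡-Reasoning
alternating-pairs b (y ∷ z ∷ xs) !xs (there m) eq =
  alternating-pairs (not b) (z ∷ xs) (AllPairs.tail !xs) m
    (trans (sym (alternating-tail b _ (z ∷ xs) (≢-sym (Unique-head !xs (pairs-∈ˡ _ m)))))
      (trans eq (alternating-tail b _ (z ∷ xs) (≢-sym (Unique-head !xs (there (pairs-∈ʳ m)))))))

alternating-last : ∀ b xs x → EvenLength xs → x ∉ xs → alternating b (xs ++ x ∷ []) x ≡ b
alternating-last b []           x _  _  = alternating-head b x []
alternating-last b (y ∷ z ∷ xs) x ev x∉ = begin
  alternating b (y ∷ z ∷ xs ++ x ∷ []) x
    ≡⟨ alternating-tail b x _ (λ x≡y → x∉ (here x≡y)) ⟩
  alternating (not b) (z ∷ xs ++ x ∷ []) x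
    ≡⟨ alternating-tail (not b) x _ (λ x≡z → x∉ (there (here x≡z))) ⟩
  alternating (not (not b)) (xs ++ x ∷ []) x
    ≡⟨ alternating-last (not (not b)) xs x ev (λ x∈ → x∉ (there (there x∈))) ⟩
  not (not b)
    ≡⟨ not-involutive b ⟩
  b ∎
  where open ≡-Reasoning

-- The inner vertices of P get alternating colours, which fits at the end of P because P has odd length.
⊕-bipartite : IsGraph H → (c : ℕ → Bool) → ProperColoring H c → (P : Ear H) →
              c (start P) ≢ c (end P) → Bipartite (H ⊕ P)
⊕-bipartite {H} gH c proper P s≢t = c′ , proper′
  where
  s t : ℕ
  s = start P
  t = end P

  c′ : ℕ → Bool
  c′ x with x ∈? inner P
  ... | yes _ = alternating (c s) (verts P) x
  ... | no  _ = c x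

  c′-outside : x ∉ inner P → c′ x ≡ c x
  c′-outside {x} x∉ with x ∈? inner P
  ... | yes x∈ = ⊥-elim (x∉ x∈)
  ... | no  _  = refl

  t-colour : c t ≡ alternating (c s) (verts P) t
  t-colour = begin
    c t
      ≡⟨ ¬-not (≢-sym s≢t) ⟩
    not (c s)
      ≡⟨ sym (alternating-last (not (c s)) (inner P) t (Ear-even P) t∉) ⟩
    alternating (not (c s)) (inner P ++ t ∷ []) t
      ≡⟨ sym (alternating-tail (c s) t _ t≢s) ⟩
    alternating (c s) (verts P) t ∎
    where
    open ≡-Reasoning
    t∉ : t ∉ inner P
    t∉ t∈ = Unique-++-disjoint (inner P) (AllPairs.tail (distinct P)) t∈ (here refl) refl
    t≢s : t ≢ s
    t≢s = ≢-sym (Unique-head (distinct P) (∈-++⁺ʳ (inner P) (here refl)))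

  c′-path : x ∈ verts P → c′ x ≡ alternating (c s) (verts P) x
  c′-path {x} x∈ with x ∈? inner P
  ... | yes _  = refl
  ... | no  x∉ with ∈-path⁻ (inner P) x∈
  ...   | inj₁ refl         = sym (alternating-head (c s) s _)
  ...   | inj₂ (inj₁ x∈i)   = ⊥-elim (x∉ x∈i)
  ...   | inj₂ (inj₂ refl)  = t-colour

  outside : V H x → x ∉ inner P
  outside xV x∈ = All.lookup (innerOut P) x∈ xV

  proper′ : ProperColoring (H ⊕ P) c′
  proper′ u v (inj₁ e) eq =
    proper u v e (trans (sym (c′-outside (outside (E-V gH e))))
                   (trans eq (c′-outside (outside (E-V gH (E-sym gH e))))))
  proper′ u v (inj₂ (inj₁ m)) eq =
    alternating-pairs (c s) (verts P) (distinct P) m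
      (trans (sym (c′-path (pairs-∈ˡ _ m))) (trans eq (c′-path (PathEdge-∈ _ (inj₂ m)))))
  proper′ u v (inj₂ (inj₂ m)) eq =
    alternating-pairs (c s) (verts P) (distinct P) m
      (trans (sym (c′-path (pairs-∈ˡ _ m))) (trans (sym eq) (c′-path (PathEdge-∈ _ (inj₂ m)))))

Bool-≢-≢ : ∀ {a b c : Bool} → a ≢ b → b ≢ c → a ≡ c
Bool-≢-≢ {c = c} a≢b b≢c = trans (¬-not a≢b) (trans (cong not (¬-not b≢c)) (not-involutive c))

path-colour-even : ∀ {c} → ProperColoring K c → PathIn K (p ∷ l ++ q ∷ []) → c p ≢ c q → EvenLength l
path-colour-even {l = []}         _      _    _   = tt
path-colour-even {l = _ ∷ []}     proper path p≢q =
  p≢q (Bool-≢-≢ (proper _ _ (path (inj₁ (here refl)))) (proper _ _ (path (inj₁ (there (here refl))))))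
path-colour-even {K} {l = _ ∷ y ∷ l} {c = c} proper path p≢q =
  path-colour-even {K} {p = y} {l = l} {c = c} proper (λ e → path (PathEdge-map (λ m → there (there m)) e))
    (λ py≡q → p≢q (trans (Bool-≢-≢ (proper _ _ (path (inj₁ (here refl))))
                                     (proper _ _ (path (inj₁ (there (here refl)))))) py≡q))

EarDecomp-E-V : BipEarDecomp n H → E H u v → V H u
EarDecomp-E-V (base _ _ _) (inj₁ (refl , _)) = inj₁ refl
EarDecomp-E-V (base _ _ _) (inj₂ (refl , _)) = inj₂ refl
EarDecomp-E-V (add d _ _)  (inj₁ e)          = inj₁ (EarDecomp-E-V d e)
EarDecomp-E-V (add _ P _)  (inj₂ pe)         = inj₂ (PathEdge-∈ (verts P) pe)

K2-ear-nontrivial : (P : Ear (K2 x y)) → Nontrivial-Ear P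
K2-ear-nontrivial record { inner = _ ∷ _ } ()
K2-ear-nontrivial
  record { inner = [] ; distinct = s∉ ∷ _ ; startV = sV ; endV = tV ; edgesOut = ¬st ∷ [] } refl =
  ¬st (K2-edge sV tV (All.head s∉))
  where
  K2-edge : (u ≡ x ⊎ u ≡ y) → (v ≡ x ⊎ v ≡ y) → u ≢ v → E (K2 x y) u v
  K2-edge (inj₁ refl) (inj₁ refl) u≢v = ⊥-elim (u≢v refl)
  K2-edge (inj₁ refl) (inj₂ refl) _   = inj₁ (refl , refl)
  K2-edge (inj₂ refl) (inj₁ refl) _   = inj₂ (refl , refl)
  K2-edge (inj₂ refl) (inj₂ refl) u≢v = ⊥-elim (u≢v refl)

avoid-two : ∀ {Q : ℕ → Set} → Q x → Q y → Q z → x ≢ y → x ≢ z → y ≢ z →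
            ∀ a b → ∃ λ w → Q w × w ≢ a × w ≢ b
avoid-two {x} {y} {z} Qx Qy Qz x≢y x≢z y≢z a b with x ≟ a | x ≟ b
... | no x≢a | no x≢b = x , Qx , x≢a , x≢b
... | yes refl | _ with y ≟ b
...   | no  y≢b  = y , Qy , ≢-sym x≢y , y≢b
...   | yes refl = z , Qz , ≢-sym x≢z , ≢-sym y≢z
avoid-two {x} {y} {z} Qx Qy Qz x≢y x≢z y≢z a b | no _ | yes refl with y ≟ a
...   | no  y≢a  = y , Qy , y≢a , ≢-sym x≢y
...   | yes refl = z , Qz , ≢-sym y≢z , ≢-sym x≢z

EarDecomp-avoiding : BipEarDecomp (suc n) H → ∀ a b → ∃ λ z → V H z × z ≢ a × z ≢ b
EarDecomp-avoiding (add (add d P′ dp′) _ _) a b =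
  let z , zV , z≢a , z≢b = EarDecomp-avoiding (add d P′ dp′) a b in z , inj₁ zV , z≢a , z≢b
EarDecomp-avoiding (add (base x y x≢y) P _) a b =
  let h , h∈ = nonempty-∈ (K2-ear-nontrivial P)
      h∉ = All.lookup (innerOut P) h∈
  in avoid-two (inj₁ (inj₁ refl)) (inj₁ (inj₂ refl)) (inj₂ (∈-path-inner (inner P) h∈)) x≢y
       (λ x≡h → h∉ (inj₁ (sym x≡h))) (λ y≡h → h∉ (inj₂ (sym y≡h))) a b

EarDecomp-vertex-off-ear : BipEarDecomp (suc n) H → (P : Ear H) → ∃ λ z → V H z × z ∉ verts P
EarDecomp-vertex-off-ear decomp P =
  let z , zV , z≢s , z≢t = EarDecomp-avoiding decomp (start P) (end P) in
  z , zV , λ z∈P → case ∈-path⁻ (inner P) z∈P of λ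
    { (inj₁ z≡s)        → z≢s z≡s
    ; (inj₂ (inj₁ z∈I)) → All.lookup (innerOut P) z∈I zV
    ; (inj₂ (inj₂ z≡t)) → z≢t z≡t }

-- S = s ∷ Y ++ t ∷ [] is a bare segment of G between the ends s, t of the ear P, whose vertex list W
-- has interior X; C = Y ++ W lists the vertices of the cycle S ∪ P, and z₀ is a vertex of G off S.
module EarAcrossSegment
  (G : Graph) (gG : IsGraph G) (c : ℕ → Bool) (proper : ProperColoring G c)
  (minimal : MinimalMatchingCovered G)
  (P : Ear G) (P-nontrivial : Nontrivial-Ear P) (P-ends : c (start P) ≢ c (end P))
  (y₁ : ℕ) (ys : List ℕ) (segment : BarePath G (start P) (y₁ ∷ ys) (end P))
  (z₀ : ℕ) (z₀V : V G z₀) (z₀∉S : z₀ ∉ start P ∷ y₁ ∷ ys ++ end P ∷ [])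
  where

  open BarePath segment renaming (unique to S-unique; edges to S-edges; bare to Y-bare)

  s t : ℕ
  s = start P
  t = end P

  X Y S W C : List ℕ
  X = inner P
  Y = y₁ ∷ ys
  S = s ∷ Y ++ t ∷ []
  W = verts P
  C = Y ++ W

  G′ : Graph
  G′ = G ⊕ P

  gG′ : IsGraph G′
  gG′ = ⊕-isGraph gG P

  sV : V G s
  sV = startV P

  tV : V G t
  tV = endV P

  outside-X : V G x → x ∉ X
  outside-X xV x∈X = All.lookup (innerOut P) x∈X xV

  X-even : EvenLength X
  X-even = Ear-even P

  Y-even : EvenLength Y
  Y-even = path-colour-even {G} {l = Y} proper S-edges P-ends

  W∩G : x ∈ W → V G x → x ≡ s ⊎ x ≡ t
  W∩G x∈W xV with ∈-path⁻ X x∈W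
  ... | inj₁ x≡s         = inj₁ x≡s
  ... | inj₂ (inj₁ x∈X)  = ⊥-elim (outside-X xV x∈X)
  ... | inj₂ (inj₂ x≡t)  = inj₂ x≡t

  Y∉W : x ∈ Y → x ∉ W
  Y∉W x∈Y x∈W with W∩G x∈W (Bare-V Y-bare x∈Y)
  ... | inj₁ refl = Unique-head S-unique (∈-++⁺ˡ x∈Y) refl
  ... | inj₂ refl = Unique-++-disjoint Y (AllPairs.tail S-unique) x∈Y (here refl) refl

  C-unique : Unique C
  C-unique = Unique.++⁺ (Unique-++⁻ˡ Y (AllPairs.tail S-unique)) (distinct P) (λ (x∈Y , x∈W) → Y∉W x∈Y x∈W)

  C-even : EvenLength C
  C-even = EvenLength-++ Y Y-even (EvenLength-path X X-even)

  S⊆C : x ∈ S → x ∈ C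
  S⊆C x∈S with ∈-path⁻ Y x∈S
  ... | inj₁ refl        = ∈-++⁺ʳ Y (here refl)
  ... | inj₂ (inj₁ x∈Y)  = ∈-++⁺ˡ x∈Y
  ... | inj₂ (inj₂ refl) = ∈-++⁺ʳ Y (∈-path-end X)

  W⊆C : x ∈ W → x ∈ C
  W⊆C = ∈-++⁺ʳ Y

  C∩G⊆S : x ∈ C → V G x → x ∈ S
  C∩G⊆S x∈C xV with ∈-++⁻ Y x∈C
  ... | inj₁ x∈Y = ∈-path-inner Y x∈Y
  ... | inj₂ x∈W with W∩G x∈W xV
  ...   | inj₁ refl = here refl
  ...   | inj₂ refl = ∈-path-end Y

  G′-vertex : V G′ x → x ∉ X → V G x
  G′-vertex (inj₁ xV)  _   = xV
  G′-vertex (inj₂ x∈W) x∉X with ∈-path⁻ X x∈W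
  ... | inj₁ refl        = sV
  ... | inj₂ (inj₁ x∈X)  = ⊥-elim (x∉X x∈X)
  ... | inj₂ (inj₂ refl) = tV

  X-bare′ : Bare G′ s X t
  X-bare′ = BarePath.bare (⊕-barePath (E-V gG) P)

  Y-bare′ : Bare G′ s Y t
  Y-bare′ = Bare-mono inj₁ G-edge Y-bare
    where
    G-edge : x ∈ Y → E G′ x z → E G x z
    G-edge _   (inj₁ e)  = e
    G-edge x∈Y (inj₂ pe) = ⊥-elim (Y∉W x∈Y (PathEdge-∈ W pe))

  extend : ∀ {M} → PerfectMatching G M → PerfectMatching G′ (Splice M [] X)
  extend pm = splice-perfect gG pm tt (Unique-++⁻ˡ X (AllPairs.tail (distinct P))) X-even
    (λ vV v∉X → G′-vertex vV v∉X , λ ())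
    (λ vV _ → outside-X vV)
    (λ Muv _ _ → inj₁ (PerfectMatching.M⊆E pm Muv))
    (λ uv → inj₂ (PathEdge-extend X (PathMatching⊆PathEdge X uv)))

  reroute-through-P : ∀ {M} → PerfectMatching G M → PairsUp M S → PerfectMatching G′ (Splice M S C)
  reroute-through-P pm pS = splice-perfect gG pm pS C-unique C-even
    (λ vV v∉C → G′-vertex vV (λ v∈X → v∉C (W⊆C (∈-path-inner X v∈X))) , λ v∈S → v∉C (S⊆C v∈S))
    (λ vV v∉S v∈C → v∉S (C∩G⊆S v∈C vV))
    (λ Muv _ _ → inj₁ (PerfectMatching.M⊆E pm Muv))
    C-edge
    where
    C-edge : PathMatching C u v → E G′ u v
    C-edge uv with PathMatching-++⁻ Y Y-even uv
    ... | inj₁ uv∈Y = inj₁ (S-edges (PathEdge-extend Y (PathMatching⊆PathEdge Y uv∈Y)))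
    ... | inj₂ uv∈W = inj₂ (PathMatching⊆PathEdge W uv∈W)

  G′-connected : Connected G′
  G′-connected u v uV vV = to-s uV ◅◅ walk-reverse (E-sym gG′) (to-s vV)
    where
    to-s : V G′ x → Walk G′ x s
    to-s (inj₁ xV)  = walk-map (λ x → x) (λ e → step (inj₁ e) here) (proj₁ (proj₁ minimal) _ s xV sV)
    to-s (inj₂ x∈W) = walk-reverse (E-sym gG′) (walk-along inj₂ x∈W)

  G′-matchingCovered : MatchingCovered G′
  G′-matchingCovered = G′-connected , nontrivial , covered
    where
    G-covered : ∀ u v → E G u v → Σ (ℕ → ℕ → Set) λ M → PerfectMatching G M × M u v
    G-covered = proj₂ (proj₂ (proj₁ minimal))

    nontrivial : Nontrivial G′
    nontrivial = let u , v , uV , vV , u≢v = proj₁ (proj₂ (proj₁ minimal)) in u , v , inj₁ uV , inj₁ vV , u≢v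

    covered : ∀ u v → E G′ u v → Σ (ℕ → ℕ → Set) λ M → PerfectMatching G′ M × M u v
    covered u v (inj₁ e) = let M , pm , Muv = G-covered u v e in _ , extend pm , inj₁ (Muv , (λ ()) , (λ ()))
    covered u v (inj₂ pe) with PathEdge-matchings (X ++ t ∷ []) pe
    ... | inj₁ uv∈W =
      let M , pm , Msy₁ = G-covered s y₁ (S-edges (inj₁ (here refl))) in
      _ , reroute-through-P pm (pairsUp-path pm Msy₁ ys S-unique Y-bare Y-even) ,
      inj₂ (PathMatching-++⁺ʳ Y Y-even uv∈W)
    ... | inj₂ uv∈X+t with PathMatching-++⁻ X X-even uv∈X+t
    ...   | inj₁ uv∈X =
      let M , pm , _ = G-covered s y₁ (S-edges (inj₁ (here refl))) in _ , extend pm , inj₂ uv∈X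
    ...   | inj₂ ()

  module OffSegment (a b : ℕ) (ab∉S : ¬ PathEdge S a b)
                    (mc′ : MatchingCovered (G′ -edge (a , b))) where

    G′-ab G-ab : Graph
    G′-ab = G′ -edge (a , b)
    G-ab  = G -edge (a , b)

    gG′-ab : IsGraph G′-ab
    gG′-ab = -edge-isGraph gG′

    gG-ab : IsGraph G-ab
    gG-ab = -edge-isGraph gG

    X-bare-ab : Bare G′-ab s X t
    X-bare-ab = Bare-mono (λ xV → xV) (λ _ → proj₁) X-bare′

    Y-bare-ab : Bare G′-ab s Y t
    Y-bare-ab = Bare-mono (λ xV → xV) (λ _ → proj₁) Y-bare′

    S-edges-ab : PathIn G-ab S
    S-edges-ab pe = S-edges pe , λ { (inj₁ (refl , refl)) → ab∉S pe
                                   ; (inj₂ (refl , refl)) → ab∉S (Sum.swap pe) }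

    restrict : ∀ {M} → PerfectMatching G′-ab M → PairsUp M X → PerfectMatching G-ab (Splice M X [])
    restrict {M} pm pX = splice-perfect gG′-ab pm pX [] tt
      (λ vV _ → inj₁ vV , outside-X vV)
      (λ _ _ ())
      old-edge
      (λ ())
      where
      old-edge : M u v → u ∉ X → v ∉ X → E G-ab u v
      old-edge Muv u∉X v∉X with PerfectMatching.M⊆E pm Muv
      ... | inj₁ e  , ¬ab = e , ¬ab
      ... | inj₂ pe , _   = ⊥-elim (Sum.[ u∉X , v∉X ] (PathEdge-meets-interior X P-nontrivial pe))

    reroute-through-S : ∀ {M} → PerfectMatching G′-ab M → PairsUp M C → PerfectMatching G-ab (Splice M C S)
    reroute-through-S {M} pm pC =
      splice-perfect gG′-ab pm pC S-unique (EvenLength-path {x = s} {y = t} Y Y-even)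
      (λ vV v∉S → inj₁ vV , λ v∈C → v∉S (C∩G⊆S v∈C vV))
      (λ _ v∉C v∈S → v∉C (S⊆C v∈S))
      old-edge
      (λ uv → S-edges-ab (PathMatching⊆PathEdge S uv))
      where
      old-edge : M u v → u ∉ C → v ∉ C → E G-ab u v
      old-edge Muv u∉C _ with PerfectMatching.M⊆E pm Muv
      ... | inj₁ e  , ¬ab = e , ¬ab
      ... | inj₂ pe , _   = ⊥-elim (u∉C (W⊆C (PathEdge-∈ W pe)))

    collapse : ℕ → ℕ
    collapse x with x ∈? X
    ... | yes _ = s
    ... | no  _ = x

    collapse-outside : x ∉ X → collapse x ≡ x
    collapse-outside {x} x∉X with x ∈? X
    ... | yes x∈X = ⊥-elim (x∉X x∈X)
    ... | no  _   = refl

    collapse-W : x ∈ W → collapse x ≡ s ⊎ collapse x ≡ t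
    collapse-W {x} x∈W with x ∈? X
    ... | yes _   = inj₁ refl
    ... | no  x∉X with ∈-path⁻ X x∈W
    ...   | inj₁ x≡s        = inj₁ x≡s
    ...   | inj₂ (inj₁ x∈X) = ⊥-elim (x∉X x∈X)
    ...   | inj₂ (inj₂ x≡t) = inj₂ x≡t

    walk-between-ends : (u ≡ s ⊎ u ≡ t) → (v ≡ s ⊎ v ≡ t) → Walk G-ab u v
    walk-between-ends (inj₁ refl) (inj₁ refl) = here
    walk-between-ends (inj₁ refl) (inj₂ refl) = walk-along S-edges-ab (∈-path-end Y)
    walk-between-ends (inj₂ refl) (inj₁ refl) =
      walk-reverse (E-sym gG-ab) (walk-along S-edges-ab (∈-path-end Y))
    walk-between-ends (inj₂ refl) (inj₂ refl) = here

    collapse-edge : E G′-ab u v → Walk G-ab (collapse u) (collapse v)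
    collapse-edge (inj₁ e , ¬ab) =
      subst₂ (Walk G-ab) (sym (collapse-outside (outside-X (E-V gG e))))
                      (sym (collapse-outside (outside-X (E-V gG (E-sym gG e)))))
                      (step (e , ¬ab) here)
    collapse-edge (inj₂ pe , _) =
      walk-between-ends (collapse-W (PathEdge-∈ W pe)) (collapse-W (PathEdge-∈ W (Sum.swap pe)))

    G-ab-connected : Connected G-ab
    G-ab-connected u v uV vV =
      subst₂ (Walk G-ab) (collapse-outside (outside-X uV)) (collapse-outside (outside-X vV))
        (walk-map collapse collapse-edge (proj₁ mc′ u v (inj₁ uV) (inj₁ vV)))

    z₀∉C : z₀ ∉ C
    z₀∉C z₀∈C = z₀∉S (C∩G⊆S z₀∈C z₀V)

    -- Interior vertices of S and W have no neighbours outside C, so the walk from z₀ to y₁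
    -- enters C at s or t.
    edge-leaving-C : ∃₂ λ y w → E G′-ab y w × w ∉ C × y ∈ S × y ∈ W
    edge-leaving-C with walk-crossing C (proj₁ mc′ z₀ y₁ (inj₁ z₀V) (inj₁ (Bare-V Y-bare (here refl))))
                                      z₀∉C (here refl)
    ... | w , y , e , w∉C , y∈C with ∈-++⁻ Y y∈C
    ...   | inj₁ y∈Y = ⊥-elim (w∉C (S⊆C (Bare-neighbour Y-bare-ab y∈Y (E-sym gG′-ab e))))
    ...   | inj₂ y∈W with ∈-path⁻ X y∈W
    ...     | inj₁ refl        = y , w , E-sym gG′-ab e , w∉C , here refl , here refl
    ...     | inj₂ (inj₁ y∈X)  = ⊥-elim (w∉C (W⊆C (Bare-neighbour X-bare-ab y∈X (E-sym gG′-ab e))))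
    ...     | inj₂ (inj₂ refl) = y , w , E-sym gG′-ab e , w∉C , ∈-path-end Y , ∈-path-end X

    matching-pairing-interiors : Σ (ℕ → ℕ → Set) λ M → PerfectMatching G′-ab M × PairsUp M Y × PairsUp M X
    matching-pairing-interiors =
      let y , w , e , w∉C , y∈S , y∈W = edge-leaving-C
          M , pm , Myw = proj₂ (proj₂ mc′) y w e
          yV = E-V gG′-ab e
      in M , pm ,
         pairsUp-interior-if-leaves pm (inj₁ sV) S-unique Y-bare-ab Y-even y∈S yV Myw
           (λ w∈S → w∉C (S⊆C w∈S)) ,
         pairsUp-interior-if-leaves pm (inj₁ sV) (distinct P) X-bare-ab X-even y∈W yV Myw
           (λ w∈W → w∉C (W⊆C w∈W))

    -- If M pairs up W then s is matched into W, hence not to y₁, so M pairs up Y as well.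
    covered-by-rerouting : ∀ {M} → PerfectMatching G′-ab M → PairsUp M W → M u v → V G u → V G v →
                           ¬ PathMatching Y u v → Σ (ℕ → ℕ → Set) λ M′ → PerfectMatching G-ab M′ × M′ u v
    covered-by-rerouting {u} {v} {M} pm pW Muv uV vV uv∉Y =
      _ , reroute-through-S pm pC ,
      inj₁ (Muv , off-C Muv uV vV uv∉Y , off-C (M-sym Muv) vV uV (λ vu → uv∉Y (PathMatching-sym Y vu)))
      where
      open PerfectMatching pm
      pY : PairsUp M Y
      pY = pairsUp-interior pm ys S-unique Y-bare-ab Y-even
             (λ My₁s → Y∉W (here refl) (PairsUp-closed pm W pW (here refl) (inj₁ sV) (M-sym My₁s)))
      pC : PairsUp M C
      pC = PairsUp-++ Y pY pW
      off-C : M x y → V G x → V G y → ¬ PathMatching Y x y → x ∉ C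
      off-C Mxy xV yV xy∉Y x∈C with PathMatching-++⁻ Y Y-even (PairsUp-partner pm C pC x∈C (inj₁ xV) Mxy)
      ... | inj₁ xy∈Y = xy∉Y xy∈Y
      ... | inj₂ xy∈W = Sum.[ outside-X xV , outside-X yV ]
                          (PathEdge-meets-interior X P-nontrivial (PathMatching⊆PathEdge W xy∈W))

    G-ab-covered : ∀ u v → E G-ab u v → Σ (ℕ → ℕ → Set) λ M → PerfectMatching G-ab M × M u v
    G-ab-covered u v (e , ¬ab) = cover (E-V gG e) (E-V gG (E-sym gG e))
      where
      cover : V G u → V G v → Σ (ℕ → ℕ → Set) λ M → PerfectMatching G-ab M × M u v
      cover uV vV with PathMatching? Y u v
      ... | yes uv∈Y =
        let M , pm , pY , pX = matching-pairing-interiors in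
        _ , restrict pm pX ,
        inj₁ (PairsUp-PathMatching (PerfectMatching.M-sym pm) Y pY uv∈Y , outside-X uV , outside-X vV)
      ... | no uv∉Y with proj₂ (proj₂ mc′) u v (inj₁ e , ¬ab)
      ...   | M , pm , Muv with pairsUp-path-or-interior pm (inj₁ sV) (distinct P) X-bare-ab X-even
      ...     | inj₁ pW = covered-by-rerouting pm pW Muv uV vV uv∉Y
      ...     | inj₂ pX = _ , restrict pm pX , inj₁ (Muv , outside-X uV , outside-X vV)

    G-ab-matchingCovered : MatchingCovered G-ab
    G-ab-matchingCovered = G-ab-connected , proj₁ (proj₂ (proj₁ minimal)) , G-ab-covered

  G′-minimal : ∀ u v → E G′ u v → ¬ MatchingCovered (G′ -edge (u , v))
  G′-minimal u v (inj₂ pe) mc =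
    bare-edge-essential gG′ mc (distinct P) P-nontrivial (inj₁ sV) (inj₁ tV) X-bare′ pe
  G′-minimal u v (inj₁ e)  mc with PathEdge? S u v
  ... | yes pe  = bare-edge-essential gG′ mc S-unique (λ ()) (inj₁ sV) (inj₁ tV) Y-bare′ pe
  ... | no  pe∉ = proj₂ minimal u v e (OffSegment.G-ab-matchingCovered u v pe∉ mc)

  minimalMatchingCovered : MinimalMatchingCovered G′
  minimalMatchingCovered = G′-matchingCovered , G′-minimal

lemma2p9 : (G : Graph) → IsGraph G → Bipartite G → MinimalMatchingCovered G →
    (j : ℕ) (H : Graph) → BipEarDecomp (suc j) H →
    (Pk : Ear H) → DiffParts H (start Pk) (end Pk) → G ≅ (H ⊕ Pk) →
    (P : Ear G) → Nontrivial-Ear P →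
    start P ∈ verts Pk → end P ∈ verts Pk → ¬ E G (start P) (end P) →
    DiffParts G (start P) (end P) →
    IsGraph (G ⊕ P) × Bipartite (G ⊕ P) × MinimalMatchingCovered (G ⊕ P)
lemma2p9 G gG (c , proper) minimal _ H decomp Pk _ G≅H⊕Pk P P-nontrivial s∈Pk t∈Pk s≁t s|t =
  ⊕-isGraph gG P , ⊕-bipartite gG c proper P P-ends ,
  minimal′ (barePath-between Pk-bare s∈Pk t∈Pk s≢t)
  where
  s≢t : start P ≢ end P
  s≢t = Unique-head (distinct P) (∈-++⁺ʳ (inner P) (here refl))

  P-ends : c (start P) ≢ c (end P)
  P-ends = s|t c proper

  Pk-bare : BarePath G (start Pk) (inner Pk) (end Pk)
  Pk-bare = BarePath-≅ G≅H⊕Pk (⊕-barePath (EarDecomp-E-V decomp) Pk)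

  minimal′ : (∃ λ ys → BarePath G (start P) ys (end P) × (start P ∷ ys ++ end P ∷ []) ⊆ verts Pk) →
             MinimalMatchingCovered (G ⊕ P)
  minimal′ ([] , segment , _) = ⊥-elim (s≁t (BarePath.edges segment (inj₁ (here refl))))
  minimal′ (y₁ ∷ ys , segment , S⊆Pk) =
    let z₀ , z₀H , z₀∉Pk = EarDecomp-vertex-off-ear decomp Pk in
    EarAcrossSegment.minimalMatchingCovered G gG c proper minimal P P-nontrivial P-ends y₁ ys segment
      z₀ (proj₂ (_≅_.V-iff G≅H⊕Pk z₀) (inj₁ z₀H)) (λ z₀∈S → z₀∉Pk (S⊆Pk z₀∈S))
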